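{- The sequence $a_n=\det(-1;T_0,T_2,\ldots,T_{2n-2})$ ($n\ge2$) satisfies $a_2=1$, $a_3=2$, and $a_n=3a_{n-1}+2a_{n-2}$ for all $n\geq4$.
   Context: The tribonacci numbers are $T_0=T_1=0$, $T_2=1$, $T_n=T_{n-1}+T_{n-2}+T_{n-3}$ for $n\geq3$. For numbers $a_0,\ldots,a_n$, $\det(a_0;a_1,\ldots,a_n)$ denotes the determinant of the $n\times n$ Toeplitz--Hessenberg matrix whose $(i,j)$ entry is $a_{i-j+1}$ if $i-j+1\ge0$ and $0$ otherwise; here the $k$-th entry after the semicolon is $T_{2k-2}$. -}

module Defs where

open import Data.Nat as ℕ using (ℕ; zero; suc; _∸_)
open import Data.Integer using (ℤ; +_; -_; _+_; _*_; -1ℤ; 0ℤ; 1ℤ)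
open import Data.Fin using (Fin; zero; suc; toℕ; punchIn)
open import Data.Nat using (_≤ᵇ_)
open import Data.Bool using (if_then_else_)

T : ℕ → ℤ
T 0 = 0ℤ
T 1 = 0ℤ
T 2 = 1ℤ
T (suc (suc (suc n))) = T (suc (suc n)) + T (suc n) + T n

sumFin : ∀ {n} → (Fin n → ℤ) → ℤ
sumFin {zero} f = 0ℤ
sumFin {suc n} f = f zero + sumFin (λ i → f (suc i))

sign : ℕ → ℤ
sign zero = 1ℤ
sign (suc k) = - sign k

det : ∀ {n} → (Fin n → Fin n → ℤ) → ℤ
det {zero} M = 1ℤ
det {suc n} M =
  sumFin (λ j → sign (toℕ j) * M zero j * det (λ i k → M (suc i) (punchIn j k)))

-- n×n Toeplitz–Hessenberg matrix with (i,j) entry a_{i-j+1} if i-j+1 ≥ 0, else 0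
-- (0-indexed i, j; the condition i - j + 1 ≥ 0 is j ≤ i + 1)
toeplitzHessenberg : (n : ℕ) → (ℕ → ℤ) → Fin n → Fin n → ℤ
toeplitzHessenberg n a i j =
  if toℕ j ≤ᵇ suc (toℕ i) then a (suc (toℕ i) ∸ toℕ j) else 0ℤ

detTH : (n : ℕ) → ℤ → (ℕ → ℤ) → ℤ
detTH n a₀ a = det (toeplitzHessenberg n (λ { zero → a₀ ; (suc k) → a (suc k) }))

a : ℕ → ℤ
a n = detTH n -1ℤ (λ k → T (2 ℕ.* k ∸ 2))

module Submission where

-- Write t for the sequence (t₀; t₁, t₂, …) = (-1; T₀, T₂, T₄, …), so a_n = det Mₙ
-- where Mₙ is the n×n Toeplitz–Hessenberg matrix of t.  Its first row is
-- (t₁, t₀, 0, …, 0), so Laplace expansion along that row has only two terms.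
-- The minor of the first entry is M_{n-1} again, but the minor of the second
-- entry has its first column shifted.  We therefore study the more general
-- determinant of the Toeplitz–Hessenberg matrix whose FIRST COLUMN is replaced
-- by an arbitrary sequence c, and show that it equals a function
-- 'columnDet t₀ s c n' (s = first column of Mₙ) given by a simple recursion.
-- This function is linear in c.  If the column s satisfies a third-order linear
-- recurrence, linearity plus three steps of the recursion show that the
-- diagonal values Dₙ = columnDet t₀ s s n satisfy a recurrence as well
-- ('recurrence-transfer').  The even-indexed tribonacci numbers satisfy
-- T_{2k+6} = 3T_{2k+4} + T_{2k+2} + T_{2k}; transferring this recurrence and
-- evaluating the coefficients at T₀ = 0, T₂ = 1, T₄ = 2 gives theorem13.

open import Defs
open import Data.Nat using (ℕ; _≥_; _∸_)
open import Data.Integer using (+_; _+_; _*_)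
open import Data.Product using (_×_)
open import Relation.Binary.PropositionalEquality using (_≡_)

open import Data.Nat as ℕ using (zero; suc)
open import Data.Integer using (ℤ; -_; _-_; -1ℤ; 0ℤ; 1ℤ)
open import Data.Fin using (Fin; zero; suc; toℕ; punchIn)
open import Data.Product using (_,_)
open import Relation.Binary.PropositionalEquality
  using (refl; sym; trans; cong; cong₂; module ≡-Reasoning)
open import Data.Integer.Tactic.RingSolver using (solve-∀)
import Data.Nat.Properties as ℕ
import Data.Integer.Properties as ℤ

open ≡-Reasoning

sumFin-cong : ∀ {n} {f g : Fin n → ℤ} → (∀ j → f j ≡ g j) → sumFin f ≡ sumFin g
sumFin-cong {zero}  e = refl
sumFin-cong {suc n} e = cong₂ _+_ (e zero) (sumFin-cong (λ j → e (suc j)))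

sumFin-zero : ∀ {n} {f : Fin n → ℤ} → (∀ j → f j ≡ 0ℤ) → sumFin f ≡ 0ℤ
sumFin-zero {zero}  e = refl
sumFin-zero {suc n} e = cong₂ _+_ (e zero) (sumFin-zero (λ j → e (suc j)))

minor : ∀ {n} → (Fin (suc n) → Fin (suc n) → ℤ) → Fin (suc n) → Fin n → Fin n → ℤ
minor M j i k = M (suc i) (punchIn j k)

det-cong : ∀ {n} {M N : Fin n → Fin n → ℤ} → (∀ i j → M i j ≡ N i j) → det M ≡ det N
det-cong {zero}  e = refl
det-cong {suc n} e = sumFin-cong λ j →
  cong₂ _*_ (cong (sign (toℕ j) *_) (e zero j))
            (det-cong (λ i k → e (suc i) (punchIn j k)))

det-twoTermRow : ∀ {m} (M : Fin (suc (suc m)) → Fin (suc (suc m)) → ℤ) →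
  (∀ j → M zero (suc (suc j)) ≡ 0ℤ) →
  det M ≡ M zero zero * det (minor M zero) - M zero (suc zero) * det (minor M (suc zero))
det-twoTermRow M rowZero =
  trans (cong (λ rest → 1ℤ * x * d₀ + (- 1ℤ * y * d₁ + rest)) (sumFin-zero vanish))
        (expand x y d₀ d₁)
  where
  x y d₀ d₁ : ℤ
  x = M zero zero
  y = M zero (suc zero)
  d₀ = det (minor M zero)
  d₁ = det (minor M (suc zero))

  vanish : ∀ j → sign (toℕ (suc (suc j))) * M zero (suc (suc j))
                   * det (minor M (suc (suc j))) ≡ 0ℤ
  vanish j = trans (cong (λ z → sign (suc (suc (toℕ j))) * z * det (minor M (suc (suc j))))
                         (rowZero j))
                   (annihilate (sign (suc (suc (toℕ j)))) (det (minor M (suc (suc j)))))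
    where
    annihilate : ∀ u v → u * 0ℤ * v ≡ 0ℤ
    annihilate = solve-∀

  expand : ∀ x y d₀ d₁ → 1ℤ * x * d₀ + (- 1ℤ * y * d₁ + 0ℤ) ≡ x * d₀ - y * d₁
  expand = solve-∀

-- Closed form of the determinant of a Toeplitz–Hessenberg matrix whose first
-- column is replaced by c: t₀ is the superdiagonal entry and s the first column
-- of the unmodified matrix.
columnDet : (t₀ : ℤ) (s c : ℕ → ℤ) → ℕ → ℤ
columnDet t₀ s c zero          = 1ℤ
columnDet t₀ s c (suc zero)    = c 0
columnDet t₀ s c (suc (suc n)) =
  c 0 * columnDet t₀ s s (suc n) - t₀ * columnDet t₀ s (λ k → c (suc k)) (suc n)

module HessenbergFamily
  (M : (n : ℕ) → Fin n → Fin n → ℤ) (t₀ : ℤ) (s : ℕ → ℤ)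
  (shift : ∀ m i k → M (suc (suc m)) (suc i) (suc k) ≡ M (suc m) i k)
  (superdiagonal : ∀ m → M (suc (suc m)) zero (suc zero) ≡ t₀)
  (aboveSuperdiagonal : ∀ m j → M (suc (suc m)) zero (suc (suc j)) ≡ 0ℤ)
  (firstColumn : ∀ n (i : Fin (suc n)) → M (suc n) i zero ≡ s (toℕ i))
  where

  withFirstColumn : (ℕ → ℤ) → (n : ℕ) → Fin n → Fin n → ℤ
  withFirstColumn c n i zero    = c (toℕ i)
  withFirstColumn c n i (suc j) = M n i (suc j)

  -- Expanding along the first row (c₀, t₀, 0, …, 0): deleting column 0 leaves
  -- M_{m+1} (with its own first column s), deleting column 1 leaves the
  -- smaller matrix with first column c shifted by one.
  det-withFirstColumn : ∀ c n → det (withFirstColumn c n) ≡ columnDet t₀ s c n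
  det-withFirstColumn c zero          = refl
  det-withFirstColumn c (suc zero)    = oneByOne (c 0)
    where
    oneByOne : ∀ x → 1ℤ * x * 1ℤ + 0ℤ ≡ x
    oneByOne = solve-∀
  det-withFirstColumn c (suc (suc m)) = begin
    det N                                                  ≡⟨ det-twoTermRow N (aboveSuperdiagonal m) ⟩
    c 0 * det (minor N zero) - N zero (suc zero) * det (minor N (suc zero))
      ≡⟨ cong₂ (λ u v → c 0 * u - v)
               (trans (det-cong minor₀) (det-withFirstColumn s (suc m)))
               (cong₂ _*_ (superdiagonal m)
                          (trans (det-cong minor₁) (det-withFirstColumn (λ k → c (suc k)) (suc m)))) ⟩
    columnDet t₀ s c (suc (suc m))                         ∎
    where
    N : Fin (suc (suc m)) → Fin (suc (suc m)) → ℤ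
    N = withFirstColumn c (suc (suc m))

    minor₀ : ∀ i k → minor N zero i k ≡ withFirstColumn s (suc m) i k
    minor₀ i zero    = trans (shift m i zero) (firstColumn m i)
    minor₀ i (suc k) = shift m i (suc k)

    minor₁ : ∀ i k → minor N (suc zero) i k ≡ withFirstColumn (λ k → c (suc k)) (suc m) i k
    minor₁ i zero    = refl
    minor₁ i (suc k) = shift m i (suc k)

  -- Replacing the first column by s itself changes nothing.
  det-columnDet : ∀ n → det (M n) ≡ columnDet t₀ s s n
  det-columnDet n = trans (det-cong (sameEntries n)) (det-withFirstColumn s n)
    where
    sameEntries : ∀ n i j → M n i j ≡ withFirstColumn s n i j
    sameEntries (suc n) i zero    = firstColumn n i
    sameEntries (suc n) i (suc j) = refl

-- columnDet is linear in the replaced column (stated for the three-term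
-- combinations produced by a third-order recurrence).
columnDet-linear : ∀ t₀ s {c c₁ c₂ c₃ : ℕ → ℤ} α β γ →
  (∀ k → c k ≡ α * c₁ k + β * c₂ k + γ * c₃ k) → ∀ n →
  columnDet t₀ s c (suc n) ≡
    α * columnDet t₀ s c₁ (suc n) + β * columnDet t₀ s c₂ (suc n) + γ * columnDet t₀ s c₃ (suc n)
columnDet-linear t₀ s α β γ comb zero    = comb 0
columnDet-linear t₀ s {c} {c₁} {c₂} {c₃} α β γ comb (suc n) =
  trans (cong₂ (λ x y → x * D - t₀ * y) (comb 0)
               (columnDet-linear t₀ s α β γ (λ k → comb (suc k)) n))
        (regroup t₀ α β γ (c₁ 0) (c₂ 0) (c₃ 0) D _ _ _)
  where
  D : ℤ
  D = columnDet t₀ s s (suc n)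

  regroup : ∀ t₀ α β γ x₁ x₂ x₃ D y₁ y₂ y₃ →
    (α * x₁ + β * x₂ + γ * x₃) * D - t₀ * (α * y₁ + β * y₂ + γ * y₃) ≡
    α * (x₁ * D - t₀ * y₁) + β * (x₂ * D - t₀ * y₂) + γ * (x₃ * D - t₀ * y₃)
  regroup = solve-∀

-- The algebra behind 'recurrence-transfer': D₂, D₃ are D_{p+2}, D_{p+3} unfolded
-- once and twice, S₁, S₂ the shifted-column determinants of size p+1.
transfer-identity : ∀ s₀ s₁ s₂ α β γ D₁ S₁ S₂ D₂ D₃ →
  D₂ ≡ s₀ * D₁ - -1ℤ * S₁ →
  D₃ ≡ s₀ * D₂ - -1ℤ * (s₁ * D₁ - -1ℤ * S₂) →
  s₀ * D₃ - -1ℤ * (s₁ * D₂ - -1ℤ * (s₂ * D₁ - -1ℤ * (α * S₂ + β * S₁ + γ * D₁))) ≡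
  (s₀ + α) * D₃ + (s₁ - α * s₀ + β) * D₂ + (s₂ - α * s₁ - β * s₀ + γ) * D₁
transfer-identity s₀ s₁ s₂ α β γ D₁ S₁ S₂ _ _ refl refl = identity s₀ s₁ s₂ α β γ D₁ S₁ S₂
  where
  identity : ∀ s₀ s₁ s₂ α β γ D₁ S₁ S₂ →
    let D₂ = s₀ * D₁ - -1ℤ * S₁
        D₃ = s₀ * D₂ - -1ℤ * (s₁ * D₁ - -1ℤ * S₂) in
    s₀ * D₃ - -1ℤ * (s₁ * D₂ - -1ℤ * (s₂ * D₁ - -1ℤ * (α * S₂ + β * S₁ + γ * D₁))) ≡
    (s₀ + α) * D₃ + (s₁ - α * s₀ + β) * D₂ + (s₂ - α * s₁ - β * s₀ + γ) * D₁
  identity = solve-∀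

recurrence-transfer : ∀ (s : ℕ → ℤ) α β γ →
  (∀ k → s (3 ℕ.+ k) ≡ α * s (2 ℕ.+ k) + β * s (1 ℕ.+ k) + γ * s k) → ∀ p →
  columnDet -1ℤ s s (4 ℕ.+ p) ≡
    (s 0 + α) * columnDet -1ℤ s s (3 ℕ.+ p)
    + (s 1 - α * s 0 + β) * columnDet -1ℤ s s (2 ℕ.+ p)
    + (s 2 - α * s 1 - β * s 0 + γ) * columnDet -1ℤ s s (1 ℕ.+ p)
recurrence-transfer s α β γ rec p =
  trans (cong (λ x → s 0 * D 3 - -1ℤ * (s 1 * D 2 - -1ℤ * (s 2 * D 1 - -1ℤ * x))) S₃-linear)
        (transfer-identity (s 0) (s 1) (s 2) α β γ (D 1) (S 1) (S 2) (D 2) (D 3) refl refl)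
  where
  D : ℕ → ℤ
  D j = columnDet -1ℤ s s (j ℕ.+ p)

  S : ℕ → ℤ
  S j = columnDet -1ℤ s (λ k → s (j ℕ.+ k)) (suc p)

  S₃-linear : S 3 ≡ α * S 2 + β * S 1 + γ * D 1
  S₃-linear = columnDet-linear -1ℤ s α β γ rec p

T-bisection : ∀ m → T (6 ℕ.+ m) ≡ + 3 * T (4 ℕ.+ m) + T (2 ℕ.+ m) + T m
T-bisection m = identity (T m) (T (1 ℕ.+ m)) (T (2 ℕ.+ m))
  where
  identity : ∀ x₀ x₁ x₂ →
    let x₃ = x₂ + x₁ + x₀ ; x₄ = x₃ + x₂ + x₁ ; x₅ = x₄ + x₃ + x₂ in
    x₅ + x₄ + x₃ ≡ + 3 * x₄ + x₂ + x₀
  identity = solve-∀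

evenT : ℕ → ℤ
evenT k = T (2 ℕ.* suc k ∸ 2)

evenT-index : ∀ j k → evenT (j ℕ.+ k) ≡ T (2 ℕ.* j ℕ.+ 2 ℕ.* k)
evenT-index j k = cong T (trans (cong (_∸ 2) (ℕ.*-suc 2 (j ℕ.+ k))) (ℕ.*-distribˡ-+ 2 j k))

evenT-recurrence : ∀ k → evenT (3 ℕ.+ k) ≡ + 3 * evenT (2 ℕ.+ k) + + 1 * evenT (1 ℕ.+ k) + + 1 * evenT k
evenT-recurrence k = begin
  evenT (3 ℕ.+ k)                                  ≡⟨ evenT-index 3 k ⟩
  T (6 ℕ.+ 2 ℕ.* k)                                ≡⟨ T-bisection (2 ℕ.* k) ⟩
  + 3 * T (4 ℕ.+ 2 ℕ.* k) + T (2 ℕ.+ 2 ℕ.* k) + T (2 ℕ.* k)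
    ≡⟨ sym (cong₂ _+_ (cong₂ _+_ (cong (+ 3 *_) (evenT-index 2 k))
                                 (trans (ℤ.*-identityˡ _) (evenT-index 1 k)))
                      (trans (ℤ.*-identityˡ _) (evenT-index 0 k))) ⟩
  + 3 * evenT (2 ℕ.+ k) + + 1 * evenT (1 ℕ.+ k) + + 1 * evenT k ∎

-- Dₙ = det(-1; T₀, T₂, …, T_{2n-2}) satisfies D_{p+4} = 3D_{p+3} + 2D_{p+2}:
-- the transferred coefficients are 0+3, 1-3·0+1 and 2-3·1-1·0+1 = 0.
evenT-det-recurrence : ∀ p →
  columnDet -1ℤ evenT evenT (4 ℕ.+ p) ≡
    + 3 * columnDet -1ℤ evenT evenT (3 ℕ.+ p) + + 2 * columnDet -1ℤ evenT evenT (2 ℕ.+ p)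
evenT-det-recurrence p =
  trans (recurrence-transfer evenT (+ 3) (+ 1) (+ 1) evenT-recurrence p)
        (trans (cong (λ z → + 3 * D 3 + + 2 * D 2 + z) (ℤ.*-zeroˡ (D 1)))
               (ℤ.+-identityʳ (+ 3 * D 3 + + 2 * D 2)))
  where
  D : ℕ → ℤ
  D j = columnDet -1ℤ evenT evenT (j ℕ.+ p)

a-columnDet : ∀ n → a n ≡ columnDet -1ℤ evenT evenT n
a-columnDet = HessenbergFamily.det-columnDet _ -1ℤ evenT
  (λ { m i zero → refl ; m i (suc k) → refl })
  (λ m → refl)
  (λ { m zero → refl ; m (suc j) → refl })
  (λ n i → refl)

theorem13 : (a 2 ≡ + 1) × (a 3 ≡ + 2)
    × (∀ (n : ℕ) → n ≥ 4 → a n ≡ + 3 * a (n ∸ 1) + + 2 * a (n ∸ 2))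
theorem13 = a-columnDet 2 , a-columnDet 3 , recurrence
  where
  recurrence : ∀ (n : ℕ) → n ≥ 4 → a n ≡ + 3 * a (n ∸ 1) + + 2 * a (n ∸ 2)
  recurrence (suc (suc (suc (suc p)))) (ℕ.s≤s (ℕ.s≤s (ℕ.s≤s (ℕ.s≤s _)))) = begin
    a (4 ℕ.+ p)                                        ≡⟨ a-columnDet (4 ℕ.+ p) ⟩
    columnDet -1ℤ evenT evenT (4 ℕ.+ p)                ≡⟨ evenT-det-recurrence p ⟩
    + 3 * columnDet -1ℤ evenT evenT (3 ℕ.+ p) + + 2 * columnDet -1ℤ evenT evenT (2 ℕ.+ p)
      ≡⟨ sym (cong₂ _+_ (cong (+ 3 *_) (a-columnDet (3 ℕ.+ p)))
                        (cong (+ 2 *_) (a-columnDet (2 ℕ.+ p)))) ⟩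
    + 3 * a (3 ℕ.+ p) + + 2 * a (2 ℕ.+ p)              ∎
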